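{- Let $G$ be a graph on $n$ vertices with minimum degree $\delta$ and maximum degree $\Delta<n-1$, and let $t$ be a positive integer such that $G$ is a $t$-expander. Then $$\mathrm{box}(G)\ge\frac{n(n-\Delta-1)}{2(t-1)\left[(n-\Delta-1)+(n-\delta-1)\right]}.$$
   Context: A graph $G=(V,E)$ is a $t$-expander if for every $S\subseteq V$ with $|S|=t$, $|\{v\in V\setminus S : uv\notin E\text{ for all }u\in S\}|<t$; equivalently the complement of $G$ contains no $K_{t,t}$ subgraph. The boxicity $\mathrm{box}(G)$ is the minimum $k$ such that there are interval graphs $I_1,\dots,I_k$ on $V$ with $E(G)=E(I_1)\cap\cdots\cap E(I_k)$.
   Formalization: The intervals representing the interval graphs $I_1,\dots,I_k$ in the definition of boxicity have rational endpoints. -}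

module Defs where

open import Data.Nat using (ℕ; _≤_; _<_; _∸_; _+_; _*_)
open import Data.Bool using (Bool; true; false; not; _∧_)
open import Data.Fin using (Fin)
open import Data.Fin.Subset using (Subset; ∣_∣)
open import Data.Vec using (tabulate; lookup)
open import Data.List.Base using (List; []; _∷_; allFin)
open import Data.Rational using (ℚ) renaming (_≤_ to _≤ℚ_)
open import Data.Product using (_×_; _,_; proj₁; proj₂; Σ; ∃)
open import Relation.Binary.PropositionalEquality using (_≡_; _≢_)
open import Function.Bundles using (_⇔_)

record Graph (n : ℕ) : Set where
  field
    adj     : Fin n → Fin n → Bool
    adj-sym : ∀ u v → adj u v ≡ adj v u
    adj-irr : ∀ v → adj v v ≡ false
open Graph public

deg : ∀ {n} → Graph n → Fin n → ℕ
deg G u = ∣ tabulate (adj G u) ∣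

IsMinDegree : ∀ {n} → Graph n → ℕ → Set
IsMinDegree {n} G δ = (∀ v → δ ≤ deg G v) × ∃ λ v → deg G v ≡ δ

IsMaxDegree : ∀ {n} → Graph n → ℕ → Set
IsMaxDegree {n} G Δ = (∀ v → deg G v ≤ Δ) × ∃ λ v → deg G v ≡ Δ

allB : {A : Set} → (A → Bool) → List A → Bool
allB p [] = true
allB p (x ∷ xs) = p x ∧ allB p xs

nonNbrs : ∀ {n} → Graph n → Subset n → Subset n
nonNbrs {n} G S =
  tabulate λ v → not (lookup S v) ∧ allB (λ u → not (lookup S u ∧ adj G u v)) (allFin n)

IsExpander : ∀ {n} → Graph n → ℕ → Set
IsExpander {n} G t = ∀ (S : Subset n) → ∣ S ∣ ≡ t → ∣ nonNbrs G S ∣ < t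

Interval : Set
Interval = Σ (ℚ × ℚ) λ p → proj₁ p ≤ℚ proj₂ p

intersects : Interval → Interval → Set
intersects ((a , b) , _) ((c , d) , _) = (a ≤ℚ d) × (c ≤ℚ b)

-- An interval representation of k interval graphs I_1..I_k on Fin n whose
-- edge sets intersect to E(G): for distinct u v,
-- uv ∈ E(G) iff the intervals of u and v meet in every I_i.
BoxRep : ∀ {n} → Graph n → ℕ → Set
BoxRep {n} G k =
  Σ (Fin k → Fin n → Interval) λ f →
    ∀ (u v : Fin n) → u ≢ v →
      (adj G u v ≡ true) ⇔ (∀ (i : Fin k) → intersects (f i u) (f i v))

module Submission where

-- Fix a box representation f of G by k interval families.  In one
-- coordinate, call a vertex u early if fewer than t intervals end no later
-- than u's, and late if fewer than t intervals start no earlier than u's;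
-- there are at most t - 1 of each.  If the intervals of u and v are disjoint
-- in that coordinate, u's lying to the left, then u is early or v is late:
-- otherwise the t intervals ending before u and the t intervals starting
-- after v form two anticomplete t-sets, which a t-expander forbids.  So the
-- set W of vertices that are early or late in some coordinate has at most
-- 2k(t - 1) elements and meets every non-edge.  Finally, double counting the
-- non-edges between V ∖ W and W shows that any W meeting every non-edge has
-- n(n - Δ - 1) ≤ |W|((n - Δ - 1) + (n - δ - 1)).

open import Defs
open import Data.Nat using (ℕ; _≤_; _<_; _∸_; _+_; _*_; zero; suc; z≤n; s≤s; _<?_)
import Data.Nat.Properties as ℕ
open import Data.Bool using (Bool; true; false; not; _∧_; _∨_)
open import Data.Bool.Properties using (∨-zeroʳ; ∧-conicalˡ; ∧-conicalʳ; not-¬; ¬-not; not-injective)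
open import Data.Fin using (Fin; zero; suc)
import Data.Fin.Properties as Fin
open import Data.Fin.Subset using (Subset; ∣_∣)
open import Data.Vec using ([]; _∷_; tabulate; lookup)
import Data.Vec.Properties as Vec
open import Data.List.Base using (List; allFin)
import Data.List.Base as List
open import Data.Rational using (ℚ; _≤?_) renaming (_≤_ to _≤ℚ_)
import Data.Rational.Properties as ℚ
open import Data.Product using (_×_; _,_; proj₁; proj₂; ∃)
open import Data.Sum using (_⊎_; inj₁; inj₂; [_,_]′)
import Data.Sum as Sum
open import Data.Empty using (⊥-elim)
open import Function.Base using (_∘_; id)
open import Function.Bundles using (Equivalence)
open import Relation.Nullary using (¬_; Dec; yes; no; does)
open import Relation.Nullary.Decidable using (dec-true; _×-dec_)
open import Relation.Binary.Core using (Rel)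
open import Relation.Binary.Definitions using (Decidable; Total; Transitive)
open import Relation.Binary.PropositionalEquality
open import Algebra.Properties.Semiring.Sum ℕ.+-*-semiring
  using (sum; sum-cong-≗; sum-replicate-zero; ∑-comm; *-distribʳ-sum)
open import Algebra.Properties.CommutativeSemigroup ℕ.+-commutativeSemigroup
  using (interchange)

VSet : ℕ → Set
VSet n = Fin n → Bool

χ : Bool → ℕ
χ true  = 1
χ false = 0

count : ∀ {n} → VSet n → ℕ
count p = sum (λ i → χ (p i))

_⊆_ : ∀ {n} → VSet n → VSet n → Set
p ⊆ q = ∀ {i} → p i ≡ true → q i ≡ true

_∪_ : ∀ {n} → VSet n → VSet n → VSet n
(p ∪ q) i = p i ∨ q i

∁ : ∀ {n} → VSet n → VSet n
∁ p i = not (p i)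

∣p∣≡count-lookup : ∀ {n} (p : Subset n) → ∣ p ∣ ≡ count (lookup p)
∣p∣≡count-lookup []          = refl
∣p∣≡count-lookup (true ∷ p)  = cong suc (∣p∣≡count-lookup p)
∣p∣≡count-lookup (false ∷ p) = ∣p∣≡count-lookup p

∣tabulate∣≡count : ∀ {n} (p : VSet n) → ∣ tabulate p ∣ ≡ count p
∣tabulate∣≡count p =
  trans (∣p∣≡count-lookup (tabulate p)) (sum-cong-≗ (cong χ ∘ Vec.lookup∘tabulate p))

sum-mono : ∀ {n} {a b : Fin n → ℕ} → (∀ i → a i ≤ b i) → sum a ≤ sum b
sum-mono {zero}  a≤b = z≤n
sum-mono {suc n} a≤b = ℕ.+-mono-≤ (a≤b zero) (sum-mono (a≤b ∘ suc))

sum-≤-uniform : ∀ {k} (a : Fin k → ℕ) {c} → (∀ i → a i ≤ c) → sum a ≤ k * c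
sum-≤-uniform {zero}  a a≤c = z≤n
sum-≤-uniform {suc k} a a≤c = ℕ.+-mono-≤ (a≤c zero) (sum-≤-uniform (a ∘ suc) (a≤c ∘ suc))

χ-mono : ∀ {a b} → (a ≡ true → b ≡ true) → χ a ≤ χ b
χ-mono {false} a⇒b = z≤n
χ-mono {true}  a⇒b rewrite a⇒b refl = ℕ.≤-refl

count-mono : ∀ {n} {p q : VSet n} → p ⊆ q → count p ≤ count q
count-mono p⊆q = sum-mono (λ i → χ-mono (p⊆q {i}))

count-empty : ∀ {n} {p : VSet n} → (∀ {i} → p i ≢ true) → count p ≡ 0
count-empty {n} {p} empty =
  ℕ.n≤0⇒n≡0 (subst (count p ≤_) (sum-replicate-zero n)
                    (count-mono {p = p} {λ _ → false} (⊥-elim ∘ empty)))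

χ-∨ : ∀ a b → χ (a ∨ b) ≤ χ a + χ b
χ-∨ true  b = s≤s z≤n
χ-∨ false b = ℕ.≤-refl

count-∪ : ∀ {n} (p q : VSet n) → count (p ∪ q) ≤ count p + count q
count-∪ {zero}  p q = z≤n
count-∪ {suc n} p q =
  ℕ.≤-trans (ℕ.+-mono-≤ (χ-∨ (p zero) (q zero)) (count-∪ (p ∘ suc) (q ∘ suc)))
            (ℕ.≤-reflexive (interchange (χ (p zero)) (χ (q zero))
                                        (count (p ∘ suc)) (count (q ∘ suc))))

χ-not : ∀ a → χ a + χ (not a) ≡ 1
χ-not true  = refl
χ-not false = refl

count-∁ : ∀ {n} (p : VSet n) → count p + count (∁ p) ≡ n
count-∁ {zero}  p = refl
count-∁ {suc n} p =
  trans (interchange (χ (p zero)) (count (p ∘ suc)) (χ (not (p zero))) (count (∁ (p ∘ suc))))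
        (cong₂ _+_ (χ-not (p zero)) (count-∁ (p ∘ suc)))

count-⊆-except : ∀ {n} {p q : VSet n} (j : Fin n) →
  (∀ {i} → i ≢ j → q i ≡ true → p i ≡ true) → count q ≤ suc (count p)
count-⊆-except {p = p} {q} zero q⊆p =
  ℕ.+-mono-≤ (χ-mono {q zero} {true} (λ _ → refl))
             (ℕ.≤-trans (count-mono {p = q ∘ suc} {p ∘ suc} (q⊆p (λ ())))
                        (ℕ.m≤n+m _ (χ (p zero))))
count-⊆-except {p = p} {q} (suc j) q⊆p =
  subst (count q ≤_) (ℕ.+-suc (χ (p zero)) (count (p ∘ suc)))
    (ℕ.+-mono-≤ (χ-mono (q⊆p (λ ())))
                (count-⊆-except j (λ i≢j → q⊆p (i≢j ∘ Fin.suc-injective))))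

count-⊂ : ∀ {n} {p q : VSet n} (j : Fin n) → p ⊆ q → p j ≡ false → q j ≡ true →
  suc (count p) ≤ count q
count-⊂ {p = p} {q} zero p⊆q pj qj rewrite pj | qj =
  s≤s (count-mono {p = p ∘ suc} {q ∘ suc} p⊆q)
count-⊂ {p = p} {q} (suc j) p⊆q pj qj =
  subst (_≤ count q) (ℕ.+-suc (χ (p zero)) (count (p ∘ suc)))
    (ℕ.+-mono-≤ (χ-mono p⊆q) (count-⊂ j p⊆q pj qj))

subset-of-size : ∀ {n} (p : VSet n) t → t ≤ count p → ∃ λ s → s ⊆ p × count s ≡ t
subset-of-size {n} p zero _ = (λ _ → false) , (λ ()) , count-empty {n} {λ _ → false} (λ ())
subset-of-size {suc n} p (suc t) t≤|p| with p zero in p₀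
... | true =
  let s , s⊆p , |s| = subset-of-size (p ∘ suc) t (ℕ.≤-pred t≤|p|)
  in (λ { zero → true ; (suc i) → s i }) ,
     (λ { {zero} _ → p₀ ; {suc i} i∈s → s⊆p i∈s }) ,
     cong suc |s|
... | false =
  let s , s⊆p , |s| = subset-of-size (p ∘ suc) (suc t) t≤|p|
  in (λ { zero → false ; (suc i) → s i }) ,
     (λ { {zero} () ; {suc i} i∈s → s⊆p i∈s }) ,
     |s|

count*≤sum : ∀ {n} (p : VSet n) (a : Fin n → ℕ) c →
  (∀ {i} → p i ≡ true → c ≤ a i) → count p * c ≤ sum a
count*≤sum p a c c≤a =
  ℕ.≤-trans (ℕ.≤-reflexive (*-distribʳ-sum c (χ ∘ p))) (sum-mono pointwise)
  where
    pointwise : ∀ i → χ (p i) * c ≤ a i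
    pointwise i with p i in i∈p
    ... | true  = subst (_≤ a i) (sym (ℕ.+-identityʳ c)) (c≤a i∈p)
    ... | false = z≤n

sum≤count* : ∀ {n} (p : VSet n) (a : Fin n → ℕ) c →
  (∀ {i} → p i ≡ true → a i ≤ c) → (∀ {i} → p i ≡ false → a i ≡ 0) → sum a ≤ count p * c
sum≤count* p a c a≤c a≡0 =
  ℕ.≤-trans (sum-mono pointwise) (ℕ.≤-reflexive (sym (*-distribʳ-sum c (χ ∘ p))))
  where
    pointwise : ∀ i → a i ≤ χ (p i) * c
    pointwise i with p i in i∈p
    ... | true  = subst (a i ≤_) (sym (ℕ.+-identityʳ c)) (a≤c i∈p)
    ... | false = ℕ.≤-reflexive (a≡0 i∈p)

⋃ : ∀ {k n} → (Fin k → VSet n) → VSet n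
⋃ {zero}  h v = false
⋃ {suc k} h v = h zero v ∨ ⋃ (h ∘ suc) v

⋃-intro : ∀ {k n} (h : Fin k → VSet n) i {v} → h i v ≡ true → ⋃ h v ≡ true
⋃-intro h zero    v∈h rewrite v∈h = refl
⋃-intro h (suc i) v∈h rewrite ⋃-intro (h ∘ suc) i v∈h = ∨-zeroʳ (h zero _)

count-⋃ : ∀ {k n} (h : Fin k → VSet n) → count (⋃ h) ≤ sum (λ i → count (h i))
count-⋃ {zero}  {n} h = ℕ.≤-reflexive (sum-replicate-zero n)
count-⋃ {suc k}     h = ℕ.≤-trans (count-∪ (h zero) (⋃ (h ∘ suc)))
                                  (ℕ.+-monoʳ-≤ (count (h zero)) (count-⋃ (h ∘ suc)))

∪-introˡ : ∀ {n} (p q : VSet n) {v} → p v ≡ true → (p ∪ q) v ≡ true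
∪-introˡ p q v∈p = cong (_∨ q _) v∈p

∪-introʳ : ∀ {n} (p q : VSet n) {v} → q v ≡ true → (p ∪ q) v ≡ true
∪-introʳ p q v∈q = trans (cong (p _ ∨_) v∈q) (∨-zeroʳ (p _))

total⇒refl : ∀ {A : Set} {ℓ} {_≼_ : Rel A ℓ} → Total _≼_ → ∀ x → x ≼ x
total⇒refl ≼-total x = [ id , id ]′ (≼-total x x)

greatest : ∀ {n ℓ} {_≼_ : Rel (Fin n) ℓ} → Total _≼_ → Transitive _≼_ → (p : VSet n) →
  (∀ i → p i ≢ true) ⊎ ∃ λ u → p u ≡ true × (∀ {w} → p w ≡ true → w ≼ u)
greatest {zero} ≼-total ≼-trans p = inj₁ (λ ())
greatest {suc n} ≼-total ≼-trans p
  with greatest (λ a b → ≼-total (suc a) (suc b)) ≼-trans (p ∘ suc) | p zero in p₀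
... | inj₁ none | false = inj₁ λ { zero → not-¬ p₀ ; (suc i) → none i }
... | inj₁ none | true  =
  inj₂ (zero , p₀ , λ { {zero} _ → total⇒refl ≼-total zero ; {suc w} w∈p → ⊥-elim (none w w∈p) })
... | inj₂ (u , u∈p , max) | false =
  inj₂ (suc u , u∈p , λ { {zero} 0∈p → ⊥-elim (not-¬ p₀ 0∈p) ; {suc w} w∈p → max w∈p })
... | inj₂ (u , u∈p , max) | true with ≼-total zero (suc u)
...   | inj₁ 0≼u =
  inj₂ (suc u , u∈p , λ { {zero} _ → 0≼u ; {suc w} w∈p → max w∈p })
...   | inj₂ u≼0 =
  inj₂ (zero , p₀ , λ { {zero} _ → total⇒refl ≼-total zero ; {suc w} w∈p → ≼-trans (max w∈p) u≼0 })

does⇒ : ∀ {a} {A : Set a} (A? : Dec A) → does A? ≡ true → A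
does⇒ (yes a) _ = a
does⇒ (no _)  ()

<⇒≤∸1 : ∀ {m n} → m < n → m ≤ n ∸ 1
<⇒≤∸1 (s≤s m≤n) = m≤n

below : ∀ {n ℓ} {_≼_ : Rel (Fin n) ℓ} → Decidable _≼_ → Fin n → VSet n
below _≼?_ u w = does (w ≼? u)

lowRank : ∀ {n ℓ} {_≼_ : Rel (Fin n) ℓ} → Decidable _≼_ → ℕ → VSet n
lowRank _≼?_ t u = does (count (below _≼?_ u) <? t)

-- For a total preorder at most t - 1 elements have low rank: all of them lie
-- below the greatest one, which has fewer than t elements below it.
count-lowRank : ∀ {n ℓ} {_≼_ : Rel (Fin n) ℓ} (_≼?_ : Decidable _≼_) →
  Total _≼_ → Transitive _≼_ → ∀ t → count (lowRank _≼?_ t) ≤ t ∸ 1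
count-lowRank _≼?_ ≼-total ≼-trans t with greatest ≼-total ≼-trans (lowRank _≼?_ t)
... | inj₁ none = subst (_≤ t ∸ 1) (sym (count-empty {p = lowRank _≼?_ t} (none _))) z≤n
... | inj₂ (u , u-low , max) =
  ℕ.≤-trans (count-mono {p = lowRank _≼?_ t} {below _≼?_ u}
                        (λ w-low → dec-true (_ ≼? u) (max w-low)))
            (<⇒≤∸1 (does⇒ (count (below _≼?_ u) <? t) u-low))

allB-true : ∀ {A : Set} (p : A → Bool) (xs : List A) → (∀ x → p x ≡ true) → allB p xs ≡ true
allB-true p List.[]       all-p = refl
allB-true p (x List.∷ xs) all-p rewrite all-p x = allB-true p xs all-p

nonNbrs-member : ∀ {n} (G : Graph n) (S : Subset n) b → lookup S b ≡ false →
  (∀ x → lookup S x ≡ true → adj G x b ≢ true) → lookup (nonNbrs G S) b ≡ true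
nonNbrs-member {n} G S b b∉S no-edge =
  trans (Vec.lookup∘tabulate _ b) (cong₂ _∧_ (cong not b∉S) (allB-true _ (allFin n) no-edge-from))
  where
    no-edge-from : ∀ x → not (lookup S x ∧ adj G x b) ≡ true
    no-edge-from x with lookup S x in x∈S
    ... | false = refl
    ... | true  = cong not (¬-not (no-edge x x∈S))

expander-anticomplete : ∀ {n} {G : Graph n} {t} → IsExpander G t → (A B : VSet n) →
  t ≤ count A → (∀ {a b} → A a ≡ true → B b ≡ true → a ≢ b × adj G a b ≢ true) →
  count B < t
expander-anticomplete {n} {G} {t} expander A B t≤|A| apart
  with subset-of-size A t t≤|A|
... | s , s⊆A , |s|≡t =
  ℕ.≤-<-trans (count-mono {p = B} {lookup (nonNbrs G S)} B⊆N)
    (subst (_< t) (∣p∣≡count-lookup (nonNbrs G S))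
      (expander S (trans (∣tabulate∣≡count s) |s|≡t)))
  where
    S : Subset n
    S = tabulate s
    ∈S : ∀ x → lookup S x ≡ true → A x ≡ true
    ∈S x x∈S = s⊆A (trans (sym (Vec.lookup∘tabulate s x)) x∈S)
    B⊆N : B ⊆ lookup (nonNbrs G S)
    B⊆N {b} b∈B = nonNbrs-member G S b (¬-not λ b∈S → proj₁ (apart (∈S b b∈S) b∈B) refl)
                    (λ x x∈S → proj₂ (apart (∈S x x∈S) b∈B))

left right : Interval → ℚ
left I  = proj₁ (proj₁ I)
right I = proj₂ (proj₁ I)

Compatible : ∀ {n} → Graph n → (Fin n → Interval) → Set
Compatible G I = ∀ u v → u ≢ v → adj G u v ≡ true → intersects (I u) (I v)

module Coordinate {n} (I : Fin n → Interval) where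

  _endsBefore?_ : Decidable (λ w u → right (I w) ≤ℚ right (I u))
  w endsBefore? u = right (I w) ≤? right (I u)

  _startsAfter?_ : Decidable (λ w v → left (I v) ≤ℚ left (I w))
  w startsAfter? v = left (I v) ≤? left (I w)

  early late : ℕ → VSet n
  early = lowRank _endsBefore?_
  late  = lowRank _startsAfter?_

  count-early : ∀ t → count (early t) ≤ t ∸ 1
  count-early = count-lowRank _endsBefore?_
    (λ a b → ℚ.≤-total (right (I a)) (right (I b))) ℚ.≤-trans

  count-late : ∀ t → count (late t) ≤ t ∸ 1
  count-late = count-lowRank _startsAfter?_
    (λ a b → ℚ.≤-total (left (I b)) (left (I a))) (λ w≼v v≼u → ℚ.≤-trans v≼u w≼v)

  -- If u's interval lies strictly left of v's, then u is early or v is late: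
  -- otherwise the t intervals ending before u and the t intervals starting
  -- after v are pairwise disjoint, giving anticomplete t-sets.
  separated : ∀ {G : Graph n} {t} → IsExpander G t → Compatible G I →
    ∀ u v → ¬ (left (I v) ≤ℚ right (I u)) → early t u ≡ true ⊎ late t v ≡ true
  separated {G} {t} expander compatible u v gap
    with count (below _endsBefore?_ u) <? t | count (below _startsAfter?_ v) <? t
  ... | yes u-early    | _            = inj₁ (dec-true (_ <? t) u-early)
  ... | no _           | yes v-late   = inj₂ (dec-true (_ <? t) v-late)
  ... | no u-not-early | no v-not-late =
    ⊥-elim (v-not-late (expander-anticomplete {G = G} expander (below _endsBefore?_ u)
                          (below _startsAfter?_ v) (ℕ.≮⇒≥ u-not-early) apart))
    where
      apart : ∀ {a b} → below _endsBefore?_ u a ≡ true → below _startsAfter?_ v b ≡ true →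
        a ≢ b × adj G a b ≢ true
      apart {a} {b} a-ends b-starts = a≢b , λ a~b → disjoint (proj₂ (compatible a b a≢b a~b))
        where
          disjoint : ¬ (left (I b) ≤ℚ right (I a))
          disjoint b≤a = gap (ℚ.≤-trans (does⇒ (b startsAfter? v) b-starts)
                                (ℚ.≤-trans b≤a (does⇒ (a endsBefore? u) a-ends)))
          a≢b : a ≢ b
          a≢b refl = disjoint (proj₂ (I a))

open Coordinate using (early; late; count-early; count-late; separated)

CoversNonEdges : ∀ {n} → Graph n → VSet n → Set
CoversNonEdges G W = ∀ u v → u ≢ v → adj G u v ≡ false → W u ≡ true ⊎ W v ≡ true

extreme : ∀ {k n} → (Fin k → Fin n → Interval) → ℕ → VSet n
extreme f t = ⋃ λ i → early (f i) t ∪ late (f i) t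

count-extreme : ∀ {k n} (f : Fin k → Fin n → Interval) t → count (extreme f t) ≤ k * (2 * (t ∸ 1))
count-extreme f t =
  ℕ.≤-trans (count-⋃ (λ i → early (f i) t ∪ late (f i) t))
            (sum-≤-uniform (λ i → count (early (f i) t ∪ late (f i) t)) per-coordinate)
  where
    per-coordinate : ∀ i → count (early (f i) t ∪ late (f i) t) ≤ 2 * (t ∸ 1)
    per-coordinate i =
      ℕ.≤-trans (count-∪ (early (f i) t) (late (f i) t))
        (subst (count (early (f i) t) + count (late (f i) t) ≤_)
               (cong ((t ∸ 1) +_) (sym (ℕ.+-identityʳ (t ∸ 1))))
               (ℕ.+-mono-≤ (count-early (f i) t) (count-late (f i) t)))

intersects? : ∀ I J → Dec (intersects I J)
intersects? I J = (left I ≤? right J) ×-dec (left J ≤? right I)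

coordinate-compatible : ∀ {n} {G : Graph n} {k} (R : BoxRep G k) i → Compatible G (proj₁ R i)
coordinate-compatible (f , rep) i u v u≢v u~v = Equivalence.to (rep u v u≢v) u~v i

early⇒extreme : ∀ {k n} (f : Fin k → Fin n → Interval) t i {v} →
  early (f i) t v ≡ true → extreme f t v ≡ true
early⇒extreme f t i = ⋃-intro _ i ∘ ∪-introˡ (early (f i) t) (late (f i) t)

late⇒extreme : ∀ {k n} (f : Fin k → Fin n → Interval) t i {v} →
  late (f i) t v ≡ true → extreme f t v ≡ true
late⇒extreme f t i = ⋃-intro _ i ∘ ∪-introʳ (early (f i) t) (late (f i) t)

-- In a t-expander the extreme vertices of a box representation meet every
-- non-edge: a non-edge uv has disjoint intervals in some coordinate i, and
-- then one of u, v is early or late in coordinate i.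
extreme-covers : ∀ {n} {G : Graph n} {t k} → IsExpander G t → (R : BoxRep G k) →
  CoversNonEdges G (extreme (proj₁ R) t)
extreme-covers {G = G} {t} {k} expander R@(f , rep) u v u≢v u≁v
  with Fin.¬∀⟶∃¬ k (λ i → intersects (f i u) (f i v)) (λ i → intersects? (f i u) (f i v))
                    (not-¬ u≁v ∘ Equivalence.from (rep u v u≢v))
... | i , disjoint with left (f i u) ≤? right (f i v)
...   | yes u≤v = Sum.map (early⇒extreme f t i) (late⇒extreme f t i)
                    (separated (f i) {G} expander (coordinate-compatible {G = G} R i) u v
                       (λ v≤u → disjoint (u≤v , v≤u)))
...   | no  u≰v = Sum.swap (Sum.map (early⇒extreme f t i) (late⇒extreme f t i)
                    (separated (f i) {G} expander (coordinate-compatible {G = G} R i) v u u≰v))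

-- The non-neighbours of v, including v itself.
nonAdj : ∀ {n} → Graph n → Fin n → VSet n
nonAdj G v w = not (adj G v w)

count-nonAdj : ∀ {n} (G : Graph n) v → count (nonAdj G v) ≡ n ∸ deg G v
count-nonAdj {n} G v = begin
  count (nonAdj G v)
    ≡⟨ ℕ.m+n∸m≡n (count (adj G v)) _ ⟨
  count (adj G v) + count (nonAdj G v) ∸ count (adj G v)
    ≡⟨ cong₂ _∸_ (count-∁ (adj G v)) (sym (∣tabulate∣≡count (adj G v))) ⟩
  n ∸ deg G v
    ∎
  where open ≡-Reasoning

-- Double counting: if W meets every non-edge of G, count the non-adjacent
-- pairs (v, w) with v ∉ W and w ∈ W.  Each v ∉ W has all of its at least
-- n - Δ - 1 non-neighbours in W, and each w ∈ W has at most n - δ - 1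
-- non-neighbours, hence (n - |W|)(n - Δ - 1) ≤ |W|(n - δ - 1).
module DoubleCounting {n} (G : Graph n) {δ Δ : ℕ}
  (δ≤deg : ∀ v → δ ≤ deg G v) (deg≤Δ : ∀ v → deg G v ≤ Δ)
  (W : VSet n) (cover : CoversNonEdges G W) where

  crossing : Fin n → Fin n → Bool
  crossing v w = not (W v) ∧ (W w ∧ nonAdj G v w)

  -- The non-neighbours of v ∉ W other than v all lie in W.
  outside-bound : ∀ v → W v ≡ false → n ∸ Δ ∸ 1 ≤ count (crossing v)
  outside-bound v v∉W = begin
    n ∸ Δ ∸ 1                 ≤⟨ ℕ.∸-monoˡ-≤ 1 (ℕ.∸-monoʳ-≤ n (deg≤Δ v)) ⟩
    n ∸ deg G v ∸ 1           ≡⟨ cong (_∸ 1) (count-nonAdj G v) ⟨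
    count (nonAdj G v) ∸ 1    ≤⟨ ℕ.∸-monoˡ-≤ 1 (count-⊆-except v nonAdj⊆crossing) ⟩
    count (crossing v)        ∎
    where
      open ℕ.≤-Reasoning
      nonAdj⊆crossing : ∀ {w} → w ≢ v → nonAdj G v w ≡ true → crossing v w ≡ true
      nonAdj⊆crossing {w} w≢v v≁w with cover v w (w≢v ∘ sym) (not-injective {y = false} v≁w)
      ... | inj₁ v∈W = ⊥-elim (not-¬ v∉W v∈W)
      ... | inj₂ w∈W rewrite v∉W | w∈W = v≁w

  -- The crossing pairs at w ∈ W are non-neighbours of w other than w.
  inside-bound : ∀ w → W w ≡ true → count (λ v → crossing v w) ≤ n ∸ δ ∸ 1
  inside-bound w w∈W = begin
    count (λ v → crossing v w) ≡⟨⟩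
    suc (count (λ v → crossing v w)) ∸ 1
                              ≤⟨ ℕ.∸-monoˡ-≤ 1 (count-⊂ w crossing⊆nonAdj ww∉crossing w≁w) ⟩
    count (nonAdj G w) ∸ 1    ≡⟨ cong (_∸ 1) (count-nonAdj G w) ⟩
    n ∸ deg G w ∸ 1           ≤⟨ ℕ.∸-monoˡ-≤ 1 (ℕ.∸-monoʳ-≤ n (δ≤deg w)) ⟩
    n ∸ δ ∸ 1                 ∎
    where
      open ℕ.≤-Reasoning
      crossing⊆nonAdj : ∀ {v} → crossing v w ≡ true → nonAdj G w v ≡ true
      crossing⊆nonAdj {v} vw =
        trans (cong not (adj-sym G w v))
              (∧-conicalʳ (W w) _ (∧-conicalʳ (not (W v)) _ vw))
      ww∉crossing : crossing w w ≡ false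
      ww∉crossing rewrite w∈W = refl
      w≁w : nonAdj G w w ≡ true
      w≁w = cong not (adj-irr G w)

  crossing-pairs : count (∁ W) * (n ∸ Δ ∸ 1) ≤ count W * (n ∸ δ ∸ 1)
  crossing-pairs = begin
    count (∁ W) * (n ∸ Δ ∸ 1)
      ≤⟨ count*≤sum (∁ W) _ _ (outside-bound _ ∘ not-injective {y = false}) ⟩
    sum (λ v → count (crossing v))
      ≡⟨ ∑-comm (λ v w → χ (crossing v w)) ⟩
    sum (λ w → count (λ v → crossing v w))
      ≤⟨ sum≤count* W _ _ (inside-bound _) crossing-into ⟩
    count W * (n ∸ δ ∸ 1)
      ∎
    where
      open ℕ.≤-Reasoning
      crossing-into : ∀ {w} → W w ≡ false → count (λ v → crossing v w) ≡ 0
      crossing-into {w} w∉W = count-empty {p = λ v → crossing v w}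
        (λ {v} vw → not-¬ w∉W (∧-conicalˡ (W w) _ (∧-conicalʳ (not (W v)) _ vw)))

  complement-cover-bound : n * (n ∸ Δ ∸ 1) ≤ count W * ((n ∸ Δ ∸ 1) + (n ∸ δ ∸ 1))
  complement-cover-bound = begin
    n * A                            ≡⟨ cong (_* A) (count-∁ W) ⟨
    (count W + count (∁ W)) * A      ≡⟨ ℕ.*-distribʳ-+ A (count W) (count (∁ W)) ⟩
    count W * A + count (∁ W) * A    ≤⟨ ℕ.+-monoʳ-≤ (count W * A) crossing-pairs ⟩
    count W * A + count W * B        ≡⟨ ℕ.*-distribˡ-+ (count W) A B ⟨
    count W * (A + B)                ∎
    where
      open ℕ.≤-Reasoning
      A = n ∸ Δ ∸ 1
      B = n ∸ δ ∸ 1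

-- Theorem 1.1: the extreme vertices of a box representation of dimension k
-- meet every non-edge and number at most 2k(t - 1).
theorem11 : ∀ (n : ℕ) (G : Graph n) (δ Δ t : ℕ) →
    IsMinDegree G δ → IsMaxDegree G Δ → Δ < n ∸ 1 →
    1 ≤ t → IsExpander G t →
    ∀ (k : ℕ) → BoxRep G k →
      n * (n ∸ Δ ∸ 1) ≤ k * (2 * (t ∸ 1) * ((n ∸ Δ ∸ 1) + (n ∸ δ ∸ 1)))
theorem11 n G δ Δ t (δ≤deg , _) (deg≤Δ , _) _ _ expander k R = begin
  n * A                          ≤⟨ DoubleCounting.complement-cover-bound G δ≤deg deg≤Δ W
                                      (extreme-covers {G = G} expander R) ⟩
  count W * (A + B)              ≤⟨ ℕ.*-monoˡ-≤ (A + B) (count-extreme (proj₁ R) t) ⟩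
  k * (2 * (t ∸ 1)) * (A + B)    ≡⟨ ℕ.*-assoc k (2 * (t ∸ 1)) (A + B) ⟩
  k * (2 * (t ∸ 1) * (A + B))    ∎
  where
    open ℕ.≤-Reasoning
    W = extreme (proj₁ R) t
    A = n ∸ Δ ∸ 1
    B = n ∸ δ ∸ 1
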